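{- Fix integers $k\ge 3$, $m\ge 2$ and $n\ge 2k+3$. For every integer $s$ with $2k+3\le s\le n$, let $V^{s,(k)}$ be the set of binary strings of length $s$ of the form $1^k0u10^k$, where $u$ is a (possibly empty) binary string such that $0u1$ contains neither $0^k$ nor $1^k$ as a factor (i.e. as a block of consecutive letters). For each such $s$, fix two distinct strings $T^{s,(k)},B^{s,(k)}\in V^{s,(k)}$. For $2\le h\le m$ and $2k+3\le s\le n$, let $M_{h,s}^{(k)}$ be the set of all $h\times s$ binary matrices whose first row is $T^{s,(k)}$, whose last row is $B^{s,(k)}$, and whose rows $2,\dots,h-1$ are strings $A_i^{s,(k)}\in V^{s,(k)}$ with $A_i^{s,(k)}\ne T^{s,(k)}$ and $A_i^{s,(k)}\ne B^{s,(k)}$ (inner rows may repeat). Let $$\mathcal V_{m,n}^{(k)}=\bigcup_{2\le h\le m,\ 2k+3\le s\le n} M_{h,s}^{(k)}.$$ Then $\mathcal V_{m,n}^{(k)}$ is a non-overlapping set of matrices: no two (not necessarily distinct) matrices in $\mathcal V_{m,n}^{(k)}$ overlap.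
   Context: Strings are over the alphabet $\{0,1\}$; $0^k$ (resp. $1^k$) denotes the string of $k$ consecutive $0$'s (resp. $1$'s). For an $r\times c$ matrix $M$ and $1\le i\le r$, $1\le j\le c$, the top-left (resp. top-right, bottom-left, bottom-right) $i\times j$ corner of $M$ is the submatrix formed by rows $1,\dots,i$ (resp. $1,\dots,i$; $r-i+1,\dots,r$; $r-i+1,\dots,r$) and columns $1,\dots,j$ (resp. $c-j+1,\dots,c$; $1,\dots,j$; $c-j+1,\dots,c$). Two matrices $A,B$ (possibly $A=B$) overlap if there is a nonempty matrix $P$ which is the bottom-right corner of one of them and the top-left corner of the other, or the bottom-left corner of one of them and the top-right corner of the other, excluding only the trivial case $A=B=P$. Equivalently, one matrix can be translated (down, right, or both, with respect to the other placed with coinciding top-left corners, and symmetrically) to a non-trivial position where all entries in the common region coincide and the common region is a corner of both. A set of matrices is non-overlapping if no two of its elements (including an element with itself) overlap. -}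

module Defs where

open import Data.Nat using (ℕ; zero; suc; _+_; _*_; _∸_; _≤_; _<_)
open import Data.Nat.Properties using (+-monoʳ-<; m∸n+n≡m; +-comm)
open import Data.Fin using (Fin; toℕ; fromℕ<; inject≤)
open import Data.Fin.Properties using (toℕ<n)
open import Data.Bool using (Bool; true; false)
open import Data.List using (List; []; _∷_; _++_; replicate; tabulate; length)
open import Data.Product using (Σ; ∃; ∃-syntax; _×_; _,_)
open import Data.Sum using (_⊎_)
open import Relation.Nullary using (¬_)
open import Relation.Binary.PropositionalEquality using (_≡_; _≢_; subst)

-- Binary strings are lists of booleans; true = 1, false = 0.
Str : Set
Str = List Bool

Factor : Str → Str → Set
Factor w u = ∃[ xs ] ∃[ ys ] (xs ++ w ++ ys ≡ u)

InV : (k s : ℕ) → Str → Set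
InV k s w =
  length w ≡ s ×
  ∃[ u ] ( (w ≡ replicate k true ++ (false ∷ u ++ (true ∷ replicate k false)))
         × ¬ Factor (replicate k false) (false ∷ u ++ (true ∷ []))
         × ¬ Factor (replicate k true)  (false ∷ u ++ (true ∷ [])) )

Mat : ℕ → ℕ → Set
Mat r c = Fin r → Fin c → Bool

row : {r c : ℕ} → Mat r c → Fin r → Str
row M i = tabulate (M i)

lastIdx : {r i : ℕ} → i ≤ r → Fin i → Fin r
lastIdx {r} {i} p a = fromℕ< lt
  where
  lt : r ∸ i + toℕ a < r
  lt = subst (r ∸ i + toℕ a <_) (m∸n+n≡m p) (+-monoʳ-< (r ∸ i) (toℕ<n a))

topLeft : {r c i j : ℕ} → Mat r c → i ≤ r → j ≤ c → Mat i j
topLeft M p q a b = M (inject≤ a p) (inject≤ b q)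

topRight : {r c i j : ℕ} → Mat r c → i ≤ r → j ≤ c → Mat i j
topRight M p q a b = M (inject≤ a p) (lastIdx q b)

bottomLeft : {r c i j : ℕ} → Mat r c → i ≤ r → j ≤ c → Mat i j
bottomLeft M p q a b = M (lastIdx p a) (inject≤ b q)

bottomRight : {r c i j : ℕ} → Mat r c → i ≤ r → j ≤ c → Mat i j
bottomRight M p q a b = M (lastIdx p a) (lastIdx q b)

_≐_ : {i j : ℕ} → Mat i j → Mat i j → Set
P ≐ Q = ∀ a b → P a b ≡ Q a b

-- A and B overlap: there is a nonempty i × j matrix P which is the
-- bottom-right corner of one and the top-left corner of the other, or the
-- bottom-left corner of one and the top-right corner of the other,
-- excluding the trivial case A = B = P (i.e. P is the whole of both).
Overlap : {r c r' c' : ℕ} → Mat r c → Mat r' c' → Set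
Overlap {r} {c} {r'} {c'} A B =
  Σ ℕ λ i → Σ ℕ λ j →
  Σ (1 ≤ i) λ _ → Σ (1 ≤ j) λ _ →
  Σ (i ≤ r) λ p → Σ (j ≤ c) λ q → Σ (i ≤ r') λ p' → Σ (j ≤ c') λ q' →
    ¬ (i ≡ r × i ≡ r' × j ≡ c × j ≡ c')
  × ( (bottomRight A p q ≐ topLeft B p' q')
    ⊎ (bottomRight B p' q' ≐ topLeft A p q)
    ⊎ (bottomLeft A p q ≐ topRight B p' q')
    ⊎ (bottomLeft B p' q' ≐ topRight A p q) )

-- M ∈ 𝒱_{m,n}^{(k)} (given the choices T^{s,(k)} = T s, B^{s,(k)} = B s):
-- M is h × s with 2 ≤ h ≤ m, 2k+3 ≤ s ≤ n, first row T s, last row B s,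
-- inner rows in V^{s,(k)} different from T s and B s.
InCalV : (k m n : ℕ) (T B : ℕ → Str) (h s : ℕ) → Mat h s → Set
InCalV k m n T B h s M =
  2 ≤ h × h ≤ m × 2 * k + 3 ≤ s × s ≤ n ×
  (∀ (i : Fin h) → toℕ i ≡ 0 → row M i ≡ T s) ×
  (∀ (i : Fin h) → toℕ i ≡ h ∸ 1 → row M i ≡ B s) ×
  (∀ (i : Fin h) → 0 < toℕ i → toℕ i < h ∸ 1 →
      InV k s (row M i) × row M i ≢ T s × row M i ≢ B s)

-- A word of V is 1ᵏ (0u1) 0ᵏ, and inside it the block 1ᵏ occurs only at the start and 0ᵏ only
-- at the end. So if a nonempty word z is a suffix of w ∈ V and a prefix of w′ ∈ V, then either
-- z begins with 1ᵏ, which forces z = w, or z is a nonempty prefix of 1ᵏ, which cannot end in 0.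
-- Reversal composed with complementation maps V onto itself, which yields the mirrored statement
-- z = w′. Hence V is cross-bifix-free. In an overlap of two matrices of 𝒱 every row of the common
-- region is such a z, so all rows involved are whole rows and coincide; as T occurs only as the
-- first row and B only as the last row of a matrix of 𝒱, the overlap comprises all rows as well.
module Submission where

open import Defs
open import Data.Bool using (Bool; true; false; not)
open import Data.Bool.Properties using (not-involutive)
open import Data.Empty using (⊥-elim)
open import Data.Fin using (Fin; toℕ; fromℕ; inject≤) renaming (zero to fzero; suc to fsuc)
open import Data.Fin.Properties using (toℕ-fromℕ; toℕ-fromℕ<; toℕ-inject≤; toℕ-injective; toℕ<n)
open import Data.List using (List; []; _∷_; _++_; [_]; replicate; reverse; map; length; tabulate)
open import Data.List.Properties
  using (++-assoc; ++-identityʳ; ∷-injective; ∷-injectiveˡ; ∷-injectiveʳ; length-++-≤ʳ; length-replicate;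
         map-++; map-∘; map-cong; map-id; length-map; reverse-++; reverse-map; reverse-involutive;
         length-reverse; tabulate-cong; length-tabulate)
open import Data.Nat using (ℕ; zero; suc; _+_; _*_; _∸_; _≤_; _<_; s≤s; _≟_)
open import Data.Nat.Properties
  using (+-identityʳ; +-∸-assoc; n∸n≡0; m∸n≡0⇒m≤n; m≤n⇒m<n∨m≡n; ≤-antisym; ≤-pred; ≤∧≢⇒<; n≢0⇒n>0)
open import Data.Product using (∃-syntax; _×_; _,_; proj₁; proj₂; map₂)
open import Data.Sum using (_⊎_; inj₁; inj₂)
open import Function using (_∘_)
open import Relation.Nullary using (¬_; yes; no)
open import Relation.Binary.PropositionalEquality
  using (_≡_; _≢_; refl; sym; trans; cong; cong₂; subst; subst₂; module ≡-Reasoning)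
open ≡-Reasoning

module _ {a} {A : Set a} where

  ++-≡-++ : ∀ (xs ys as bs : List A) → xs ++ ys ≡ as ++ bs →
            ∃[ m ] ((as ≡ xs ++ m × ys ≡ m ++ bs) ⊎ (xs ≡ as ++ m × bs ≡ m ++ ys))
  ++-≡-++ []       ys as       bs eq = as , inj₁ (refl , eq)
  ++-≡-++ (x ∷ xs) ys []       bs eq = x ∷ xs , inj₂ (refl , sym eq)
  ++-≡-++ (x ∷ xs) ys (a ∷ as) bs eq with refl , eq′ ← ∷-injective eq
    with m , split ← ++-≡-++ xs ys as bs eq′ = m , cons split
    where
    cons : (as ≡ xs ++ m × ys ≡ m ++ bs) ⊎ (xs ≡ as ++ m × bs ≡ m ++ ys) →
           (x ∷ as ≡ x ∷ xs ++ m × ys ≡ m ++ bs) ⊎ (x ∷ xs ≡ x ∷ as ++ m × bs ≡ m ++ ys)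
    cons (inj₁ (e , e′)) = inj₁ (cong (x ∷_) e , e′)
    cons (inj₂ (e , e′)) = inj₂ (cong (x ∷_) e , e′)

  replicate-≡-++-∷ : ∀ n {c d : A} m {t} → replicate n c ≡ m ++ d ∷ t → d ≡ c
  replicate-≡-++-∷ zero    []      ()
  replicate-≡-++-∷ zero    (_ ∷ _) ()
  replicate-≡-++-∷ (suc n) []      eq = sym (∷-injectiveˡ eq)
  replicate-≡-++-∷ (suc n) (_ ∷ m) eq = replicate-≡-++-∷ n m (∷-injectiveʳ eq)

  replicate-++-≡-++-∷ : ∀ n {c d : A} ys m {t} → replicate n c ++ ys ≡ m ++ d ∷ t → length m < n → d ≡ c
  replicate-++-≡-++-∷ (suc n) ys []      eq _         = sym (∷-injectiveˡ eq)
  replicate-++-≡-++-∷ (suc n) ys (_ ∷ m) eq (s≤s m<n) = replicate-++-≡-++-∷ n ys m (∷-injectiveʳ eq) m<n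

  replicate-∷ʳ : ∀ n (x : A) → replicate n x ++ [ x ] ≡ x ∷ replicate n x
  replicate-∷ʳ zero    x = refl
  replicate-∷ʳ (suc n) x = cong (x ∷_) (replicate-∷ʳ n x)

tabulate-inject≤ : ∀ {a} {A : Set a} {c j} (f : Fin c → A) (q : j ≤ c) →
                   ∃[ ys ] tabulate (λ b → f (inject≤ b q)) ++ ys ≡ tabulate f
tabulate-inject≤ {j = zero} f q = tabulate f , refl
tabulate-inject≤ {c = suc c} {suc j} f (s≤s q) with ys , eq ← tabulate-inject≤ (f ∘ fsuc) q =
  ys , cong (f fzero ∷_) eq

toℕ-lastIdx : ∀ {r i} (p : i ≤ r) (a : Fin i) → toℕ (lastIdx p a) ≡ r ∸ i + toℕ a
toℕ-lastIdx p a = toℕ-fromℕ< _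

tabulate-lastIdx : ∀ {a} {A : Set a} {c j} (f : Fin c → A) (q : j ≤ c) →
                   ∃[ xs ] xs ++ tabulate (λ b → f (lastIdx q b)) ≡ tabulate f
tabulate-lastIdx {c = c} f q with m≤n⇒m<n∨m≡n q
... | inj₂ refl = [] , tabulate-cong (λ b → cong f (toℕ-injective (trans (toℕ-lastIdx q b) (cong (_+ toℕ b) (n∸n≡0 c)))))
... | inj₁ (s≤s j≤c′) with xs , eq ← tabulate-lastIdx (f ∘ fsuc) j≤c′ =
  f fzero ∷ xs , cong (f fzero ∷_) (trans (cong (xs ++_) (tabulate-cong (λ b → cong f (shift b)))) eq)
  where
  shift : ∀ b → lastIdx q b ≡ fsuc (lastIdx j≤c′ b)
  shift b = toℕ-injective (trans (toℕ-lastIdx q b)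
    (trans (cong (_+ toℕ b) (+-∸-assoc 1 j≤c′)) (cong suc (sym (toℕ-lastIdx j≤c′ b)))))

Factor-++-replicate⁻ : ∀ {k n} {c d : Bool} v → c ≢ d →
                       Factor (replicate k c) (v ++ replicate n d) → Factor (replicate k c) v
Factor-++-replicate⁻ {zero} v _ _ = [] , v , refl
Factor-++-replicate⁻ {suc k} {n} {c} {d} v c≢d (xs , ys , eq) with ++-≡-++ xs _ v _ eq
... | q , inj₂ (_ , dⁿ≡q++cᵏ++ys) = ⊥-elim (c≢d (replicate-≡-++-∷ n q dⁿ≡q++cᵏ++ys))
... | q , inj₁ (v≡xs++q , cᵏ++ys≡q++dⁿ) with ++-≡-++ (replicate (suc k) c) ys q _ cᵏ++ys≡q++dⁿ
...   | q′ , inj₁ (q≡cᵏ++q′ , _) = xs , q′ , sym (trans v≡xs++q (cong (xs ++_) q≡cᵏ++q′))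
...   | [] , inj₂ (cᵏ≡q++[] , _) =
        xs , [] , trans (cong (xs ++_) (trans (++-identityʳ _) (trans cᵏ≡q++[] (++-identityʳ q)))) (sym v≡xs++q)
...   | _ ∷ _ , inj₂ (cᵏ≡q++q′ , dⁿ≡q′++ys) =
        ⊥-elim (c≢d (trans (sym (replicate-≡-++-∷ (suc k) q cᵏ≡q++q′)) (replicate-≡-++-∷ n [] dⁿ≡q′++ys)))

mirror : Str → Str
mirror = reverse ∘ map not

mirror-++ : ∀ xs ys → mirror (xs ++ ys) ≡ mirror ys ++ mirror xs
mirror-++ xs ys = trans (cong reverse (map-++ not xs ys)) (reverse-++ (map not xs) (map not ys))

mirror-replicate : ∀ n c → mirror (replicate n c) ≡ replicate n (not c)
mirror-replicate zero    c = refl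
mirror-replicate (suc n) c = begin
  mirror ([ c ] ++ replicate n c)     ≡⟨ mirror-++ [ c ] (replicate n c) ⟩
  mirror (replicate n c) ++ [ not c ] ≡⟨ cong (_++ [ not c ]) (mirror-replicate n c) ⟩
  replicate n (not c) ++ [ not c ]    ≡⟨ replicate-∷ʳ n (not c) ⟩
  replicate (suc n) (not c)           ∎

mirror-involutive : ∀ w → mirror (mirror w) ≡ w
mirror-involutive w = begin
  reverse (map not (reverse (map not w))) ≡⟨ cong reverse (reverse-map not (map not w)) ⟩
  reverse (reverse (map not (map not w))) ≡⟨ reverse-involutive _ ⟩
  map not (map not w)                     ≡⟨ map-∘ w ⟨
  map (not ∘ not) w                       ≡⟨ map-cong not-involutive w ⟩
  map (λ x → x) w                         ≡⟨ map-id w ⟩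
  w                                       ∎

mirror-≡-[] : ∀ {w} → mirror w ≡ [] → w ≡ []
mirror-≡-[] {w} eq = trans (sym (mirror-involutive w)) (cong mirror eq)

length-mirror : ∀ w → length (mirror w) ≡ length w
length-mirror w = trans (length-reverse (map not w)) (length-map not w)

Factor-mirror : ∀ {x y} → Factor x y → Factor (mirror x) (mirror y)
Factor-mirror {x} {y} (xs , ys , eq) = mirror ys , mirror xs , (begin
  mirror ys ++ mirror x ++ mirror xs ≡⟨ cong (mirror ys ++_) (mirror-++ xs x) ⟨
  mirror ys ++ mirror (xs ++ x)      ≡⟨ mirror-++ (xs ++ x) ys ⟨
  mirror ((xs ++ x) ++ ys)           ≡⟨ cong mirror (trans (++-assoc xs x ys) eq) ⟩
  mirror y                           ∎)

inner : Str → Str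
inner u = false ∷ u ++ [ true ]

framed : ∀ k u → replicate k true ++ (false ∷ u ++ true ∷ replicate k false) ≡
                 replicate k true ++ inner u ++ replicate k false
framed k u = cong (λ t → replicate k true ++ false ∷ t) (sym (++-assoc u [ true ] (replicate k false)))

mirror-inner : ∀ u → mirror (inner u) ≡ inner (mirror u)
mirror-inner u = trans (mirror-++ (false ∷ u) [ true ]) (cong (false ∷_) (mirror-++ [ false ] u))

InV-mirror : ∀ {k s w} → InV k s w → InV k s (mirror w)
InV-mirror {k} (length≡s , u , refl , no0ᵏ , no1ᵏ) =
  trans (length-mirror w) length≡s , mirror u , shape , no1ᵏ ∘ flip true , no0ᵏ ∘ flip false
  where
  1ᵏ = replicate k true
  0ᵏ = replicate k false
  w = 1ᵏ ++ (false ∷ u ++ true ∷ 0ᵏ)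
  shape : mirror w ≡ 1ᵏ ++ (false ∷ mirror u ++ true ∷ 0ᵏ)
  shape = begin
    mirror w                                     ≡⟨ cong mirror (framed k u) ⟩
    mirror (1ᵏ ++ inner u ++ 0ᵏ)                 ≡⟨ mirror-++ 1ᵏ _ ⟩
    mirror (inner u ++ 0ᵏ) ++ mirror 1ᵏ          ≡⟨ cong (_++ mirror 1ᵏ) (mirror-++ (inner u) 0ᵏ) ⟩
    (mirror 0ᵏ ++ mirror (inner u)) ++ mirror 1ᵏ ≡⟨ cong₂ (λ x y → (x ++ mirror (inner u)) ++ y)
                                                          (mirror-replicate k false) (mirror-replicate k true) ⟩
    (1ᵏ ++ mirror (inner u)) ++ 0ᵏ               ≡⟨ ++-assoc 1ᵏ _ 0ᵏ ⟩
    1ᵏ ++ mirror (inner u) ++ 0ᵏ                 ≡⟨ cong (λ t → 1ᵏ ++ t ++ 0ᵏ) (mirror-inner u) ⟩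
    1ᵏ ++ inner (mirror u) ++ 0ᵏ                 ≡⟨ framed k (mirror u) ⟨
    1ᵏ ++ (false ∷ mirror u ++ true ∷ 0ᵏ)        ∎
  flip : ∀ c → Factor (replicate k (not c)) (inner (mirror u)) → Factor (replicate k c) (inner u)
  flip c f = subst₂ Factor
    (trans (mirror-replicate k (not c)) (cong (replicate k) (not-involutive c)))
    (trans (cong mirror (sym (mirror-inner u))) (mirror-involutive (inner u)))
    (Factor-mirror f)

InV-zero : ∀ {s w} → ¬ InV 0 s w
InV-zero (_ , _ , _ , no0ᵏ , _) = no0ᵏ ([] , _ , refl)

InV-head : ∀ {k s c w} → InV k s (c ∷ w) → c ≡ true
InV-head {zero}  vw                   = ⊥-elim (InV-zero vw)
InV-head {suc k} (_ , _ , eq , _ , _) = ∷-injectiveˡ eq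

InV-1ᵏ-only-at-start : ∀ {k s w} xs ys → InV k s w → xs ++ replicate k true ++ ys ≡ w → xs ≡ []
InV-1ᵏ-only-at-start {zero} _ _ vw _ = ⊥-elim (InV-zero vw)
InV-1ᵏ-only-at-start {suc k} xs ys (_ , u , refl , _ , no1ᵏ) eq with ++-≡-++ xs _ (replicate (suc k) true) _ eq
... | m , inj₂ (_ , tail≡m++1ᵏ++ys) =
      ⊥-elim (no1ᵏ (Factor-++-replicate⁻ (inner u) (λ ()) (m , ys , sym inner++0ᵏ≡m++1ᵏ++ys)))
  where
  inner++0ᵏ≡m++1ᵏ++ys : inner u ++ replicate (suc k) false ≡ m ++ replicate (suc k) true ++ ys
  inner++0ᵏ≡m++1ᵏ++ys = trans (cong (false ∷_) (++-assoc u [ true ] _)) tail≡m++1ᵏ++ys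
... | m , inj₁ (1ᵏ≡xs++m , 1ᵏ++ys≡m++tail) with xs
...   | []      = refl
...   | _ ∷ xs′ = ⊥-elim (false≢true (replicate-++-≡-++-∷ (suc k) ys m 1ᵏ++ys≡m++tail (s≤s m≤k)))
  where
  false≢true : false ≢ true
  false≢true ()
  m≤k : length m ≤ k
  m≤k = subst (length m ≤_) (trans (cong length (sym (∷-injectiveʳ 1ᵏ≡xs++m))) (length-replicate k))
              (length-++-≤ʳ m {xs′})

-- z consists of 1s, yet its last letter is that of w, namely 0; mirroring turns last letters into
-- first ones, where InV-head applies.
InV-suffix-prefix-of-1ᵏ⇒[] : ∀ {k s w} xs z m → InV k s w → xs ++ z ≡ w → z ++ m ≡ replicate k true → z ≡ []
InV-suffix-prefix-of-1ᵏ⇒[] {k} {s} {w} xs z m vw xs++z≡w z++m≡1ᵏ with mirror z in mz≡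
... | []    = mirror-≡-[] mz≡
... | c ∷ t = ⊥-elim (true≢false (trans (sym c≡true) c≡false))
  where
  true≢false : true ≢ false
  true≢false ()
  c≡false : c ≡ false
  c≡false = replicate-≡-++-∷ k (mirror m) (begin
    replicate k false         ≡⟨ mirror-replicate k true ⟨
    mirror (replicate k true) ≡⟨ cong mirror z++m≡1ᵏ ⟨
    mirror (z ++ m)           ≡⟨ mirror-++ z m ⟩
    mirror m ++ mirror z      ≡⟨ cong (mirror m ++_) mz≡ ⟩
    mirror m ++ c ∷ t         ∎)
  c≡true : c ≡ true
  c≡true = InV-head (subst (InV k s) (begin
    mirror w                  ≡⟨ cong mirror xs++z≡w ⟨
    mirror (xs ++ z)          ≡⟨ mirror-++ xs z ⟩
    mirror z ++ mirror xs     ≡⟨ cong (_++ mirror xs) mz≡ ⟩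
    c ∷ t ++ mirror xs        ∎) (InV-mirror vw))

InV-suffix≡prefix⇒suffix-whole : ∀ {k s s′ w w′} xs z ys → InV k s w → InV k s′ w′ → z ≢ [] →
                                 xs ++ z ≡ w → z ++ ys ≡ w′ → xs ≡ []
InV-suffix≡prefix⇒suffix-whole {k} xs z ys vw (_ , _ , refl , _) z≢[] xs++z≡w z++ys≡w′
  with ++-≡-++ z ys (replicate k true) _ z++ys≡w′
... | m , inj₁ (1ᵏ≡z++m , _) = ⊥-elim (z≢[] (InV-suffix-prefix-of-1ᵏ⇒[] xs z m vw xs++z≡w (sym 1ᵏ≡z++m)))
... | m , inj₂ (z≡1ᵏ++m , _) = InV-1ᵏ-only-at-start xs m vw (trans (cong (xs ++_) (sym z≡1ᵏ++m)) xs++z≡w)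

InV-suffix≡prefix⇒equal : ∀ {k s s′ w w′ z} → InV k s w → InV k s′ w′ → z ≢ [] →
                          ∃[ xs ] xs ++ z ≡ w → ∃[ ys ] z ++ ys ≡ w′ → w ≡ z × w′ ≡ z
InV-suffix≡prefix⇒equal {z = z} vw vw′ z≢[] (xs , xs++z≡w) (ys , z++ys≡w′)
  with refl ← InV-suffix≡prefix⇒suffix-whole xs z ys vw vw′ z≢[] xs++z≡w z++ys≡w′
  with refl ← mirror-≡-[] {ys} (InV-suffix≡prefix⇒suffix-whole (mirror ys) (mirror z) (mirror xs)
                                 (InV-mirror vw′) (InV-mirror vw) (z≢[] ∘ mirror-≡-[])
                                 (trans (sym (mirror-++ z ys)) (cong mirror z++ys≡w′))
                                 (trans (sym (mirror-++ xs z)) (cong mirror xs++z≡w)))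
  = sym xs++z≡w , trans (sym z++ys≡w′) (++-identityʳ z)

tabulate-suffix≡prefix⇒equal : ∀ {k c c′ j} {f : Fin c → Bool} {g : Fin c′ → Bool} →
  InV k c (tabulate f) → InV k c′ (tabulate g) → 0 < j → (q : j ≤ c) (q′ : j ≤ c′) →
  (∀ b → f (lastIdx q b) ≡ g (inject≤ b q′)) → j ≡ c × j ≡ c′ × tabulate f ≡ tabulate g
tabulate-suffix≡prefix⇒equal {j = suc _} {f} {g} vf vg _ q q′ f≗g
  with f≡z , g≡z ← InV-suffix≡prefix⇒equal vf vg (λ ())
                     (map₂ (λ {xs} → trans (cong (xs ++_) (sym (tabulate-cong f≗g)))) (tabulate-lastIdx f q))
                     (tabulate-inject≤ g q′)
  = length-z≡ f f≡z , length-z≡ g g≡z , trans f≡z (sym g≡z)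
  where
  length-z≡ : ∀ {c} (h : Fin c → Bool) → tabulate h ≡ tabulate (λ b → g (inject≤ b q′)) → _ ≡ c
  length-z≡ h h≡z =
    trans (sym (length-tabulate (λ b → g (inject≤ b q′)))) (trans (cong length (sym h≡z)) (length-tabulate h))

toℕ-first-last-or-inner : ∀ {h} (i : Fin h) → toℕ i ≡ 0 ⊎ toℕ i ≡ h ∸ 1 ⊎ (0 < toℕ i × toℕ i < h ∸ 1)
toℕ-first-last-or-inner {suc h} i with toℕ i ≟ 0 | toℕ i ≟ h
... | yes i≡0 | _       = inj₁ i≡0
... | no _    | yes i≡h = inj₂ (inj₁ i≡h)
... | no i≢0  | no i≢h  = inj₂ (inj₂ (n≢0⇒n>0 i≢0 , ≤∧≢⇒< (≤-pred (toℕ<n i)) i≢h))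

module _ {k m n : ℕ} {T B : ℕ → Str}
         (TB-valid : ∀ s → 2 * k + 3 ≤ s → s ≤ n → InV k s (T s) × InV k s (B s) × T s ≢ B s) where

  rows-InV : ∀ {h s} {M : Mat h s} → InCalV k m n T B h s M → ∀ i → InV k s (row M i)
  rows-InV {s = s} (_ , _ , 2k+3≤s , s≤n , first , last , inner) i
    with toℕ-first-last-or-inner i | TB-valid s 2k+3≤s s≤n
  ... | inj₁ i≡0                  | vT , _      = subst (InV k s) (sym (first i i≡0)) vT
  ... | inj₂ (inj₁ i≡h-1)         | _ , vB , _  = subst (InV k s) (sym (last i i≡h-1)) vB
  ... | inj₂ (inj₂ (0<i , i<h-1)) | _           = proj₁ (inner i 0<i i<h-1)

  row≡T⇒first : ∀ {h s} {M : Mat h s} → InCalV k m n T B h s M → ∀ i → row M i ≡ T s → toℕ i ≡ 0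
  row≡T⇒first {s = s} (_ , _ , 2k+3≤s , s≤n , _ , last , inner) i Mi≡T
    with toℕ-first-last-or-inner i | TB-valid s 2k+3≤s s≤n
  ... | inj₁ i≡0                  | _           = i≡0
  ... | inj₂ (inj₁ i≡h-1)         | _ , _ , T≢B = ⊥-elim (T≢B (trans (sym Mi≡T) (last i i≡h-1)))
  ... | inj₂ (inj₂ (0<i , i<h-1)) | _           = ⊥-elim (proj₁ (proj₂ (inner i 0<i i<h-1)) Mi≡T)

  row≡B⇒last : ∀ {h s} {M : Mat h s} → InCalV k m n T B h s M → ∀ i → row M i ≡ B s → toℕ i ≡ h ∸ 1
  row≡B⇒last {s = s} (_ , _ , 2k+3≤s , s≤n , first , _ , inner) i Mi≡B
    with toℕ-first-last-or-inner i | TB-valid s 2k+3≤s s≤n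
  ... | inj₁ i≡0                  | _ , _ , T≢B = ⊥-elim (T≢B (trans (sym (first i i≡0)) Mi≡B))
  ... | inj₂ (inj₁ i≡h-1)         | _           = i≡h-1
  ... | inj₂ (inj₂ (0<i , i<h-1)) | _           = ⊥-elim (proj₂ (proj₂ (inner i 0<i i<h-1)) Mi≡B)

  aligned-rows⇒full-height : ∀ {h s h′ s′ i} {M : Mat h s} {N : Mat h′ s′} →
    InCalV k m n T B h s M → InCalV k m n T B h′ s′ N → 0 < i → (p : i ≤ h) (p′ : i ≤ h′) →
    (∀ a → row M (lastIdx p a) ≡ row N (inject≤ a p′)) → i ≡ h × i ≡ h′
  aligned-rows⇒full-height {h} {i = suc i} {M} {N}
                           cM@(_ , _ , _ , _ , _ , lastM , _) cN@(_ , _ , _ , _ , firstN , _) _ p p′@(s≤s _) M≡N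
    with refl ← trans (sym (length-tabulate (M (lastIdx p fzero))))
                      (trans (cong length (M≡N fzero)) (length-tabulate (N (inject≤ fzero p′))))
    with refl ← ≤-antisym p (m∸n≡0⇒m≤n (begin
                  h ∸ suc i             ≡⟨ +-identityʳ (h ∸ suc i) ⟨
                  h ∸ suc i + 0         ≡⟨ toℕ-lastIdx p fzero ⟨
                  toℕ (lastIdx p fzero) ≡⟨ row≡T⇒first cM _ (trans (M≡N fzero) (firstN _ refl)) ⟩
                  0                     ∎))
    = refl , cong suc (begin
        i                          ≡⟨ toℕ-fromℕ i ⟨
        toℕ (fromℕ i)              ≡⟨ toℕ-inject≤ (fromℕ i) p′ ⟨
        toℕ (inject≤ (fromℕ i) p′) ≡⟨ row≡B⇒last cN _ (trans (sym (M≡N (fromℕ i))) (lastM _ lastIdx≡i)) ⟩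
        _                          ∎)
    where
    lastIdx≡i : toℕ (lastIdx p (fromℕ i)) ≡ i
    lastIdx≡i = trans (toℕ-lastIdx p (fromℕ i)) (cong₂ _+_ (n∸n≡0 i) (toℕ-fromℕ i))

  bottomRight≐topLeft⇒whole : ∀ {h s h′ s′ i j} {M : Mat h s} {N : Mat h′ s′} →
    InCalV k m n T B h s M → InCalV k m n T B h′ s′ N → 0 < i → 0 < j →
    (p : i ≤ h) (q : j ≤ s) (p′ : i ≤ h′) (q′ : j ≤ s′) →
    bottomRight M p q ≐ topLeft N p′ q′ → i ≡ h × i ≡ h′ × j ≡ s × j ≡ s′
  bottomRight≐topLeft⇒whole {i = suc _} cM cN 0<i 0<j p q p′ q′ M≐N =
    let j≡s , j≡s′ , _ = rows fzero
        i≡h , i≡h′ = aligned-rows⇒full-height cM cN 0<i p p′ (λ a → proj₂ (proj₂ (rows a)))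
    in i≡h , i≡h′ , j≡s , j≡s′
    where
    rows = λ a → tabulate-suffix≡prefix⇒equal (rows-InV cM _) (rows-InV cN _) 0<j q q′ (M≐N a)

  bottomLeft≐topRight⇒whole : ∀ {h s h′ s′ i j} {M : Mat h s} {N : Mat h′ s′} →
    InCalV k m n T B h s M → InCalV k m n T B h′ s′ N → 0 < i → 0 < j →
    (p : i ≤ h) (q : j ≤ s) (p′ : i ≤ h′) (q′ : j ≤ s′) →
    bottomLeft M p q ≐ topRight N p′ q′ → i ≡ h × i ≡ h′ × j ≡ s × j ≡ s′
  bottomLeft≐topRight⇒whole {i = suc _} cM cN 0<i 0<j p q p′ q′ M≐N =
    let j≡s′ , j≡s , _ = rows fzero
        i≡h , i≡h′ = aligned-rows⇒full-height cM cN 0<i p p′ (λ a → sym (proj₂ (proj₂ (rows a))))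
    in i≡h , i≡h′ , j≡s , j≡s′
    where
    rows = λ a → tabulate-suffix≡prefix⇒equal (rows-InV cN _) (rows-InV cM _) 0<j q′ q (λ b → sym (M≐N a b))

mainTheorem1 : (k m n : ℕ) → 3 ≤ k → 2 ≤ m → 2 * k + 3 ≤ n →
    (T B : ℕ → Str) →
    (∀ s → 2 * k + 3 ≤ s → s ≤ n → InV k s (T s) × InV k s (B s) × T s ≢ B s) →
    ∀ (h s : ℕ) (M : Mat h s) (h' s' : ℕ) (N : Mat h' s') →
    InCalV k m n T B h s M → InCalV k m n T B h' s' N →
    ¬ Overlap M N
mainTheorem1 k m n _ _ _ T B TB-valid h s M h' s' N cM cN (i , j , 0<i , 0<j , p , q , p′ , q′ , nontrivial , corners)
  with corners
... | inj₁ M≐N =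
      nontrivial (bottomRight≐topLeft⇒whole TB-valid cM cN 0<i 0<j p q p′ q′ M≐N)
... | inj₂ (inj₁ N≐M) =
      let i≡h′ , i≡h , j≡s′ , j≡s = bottomRight≐topLeft⇒whole TB-valid cN cM 0<i 0<j p′ q′ p q N≐M
      in nontrivial (i≡h , i≡h′ , j≡s , j≡s′)
... | inj₂ (inj₂ (inj₁ M≐N)) =
      nontrivial (bottomLeft≐topRight⇒whole TB-valid cM cN 0<i 0<j p q p′ q′ M≐N)
... | inj₂ (inj₂ (inj₂ N≐M)) =
      let i≡h′ , i≡h , j≡s′ , j≡s = bottomLeft≐topRight⇒whole TB-valid cN cM 0<i 0<j p′ q′ p q N≐M
      in nontrivial (i≡h , i≡h′ , j≡s , j≡s′)
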